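{- Let $n$ be an even integer with $2 < n \le 10^7$ such that $n$ is not a power of $2$ and $n \notin \{161038, 215326, 2568226, 3020626, 7866046, 9115426\}$. Then the $n$-dimensional hypercube $Q_n$ does not contain $n/2$ completely independent spanning trees.
   Context: The $n$-dimensional hypercube $Q_n$ is the graph whose vertices are the binary strings of length $n$, two strings being adjacent iff they differ in exactly one coordinate; it is $n$-regular, $n$-connected and bipartite with $2^n$ vertices. For a tree $T$ and vertices $u,v$ of $T$, let $P_T(u,v)$ denote the set of vertices on the unique $u$–$v$ path in $T$. Spanning trees $T_1,\dots,T_m$ of a graph $G$ are called completely independent spanning trees (CISTs) if they are pairwise edge-disjoint and, for every pair of distinct trees $T_i,T_j$ and every pair of vertices $u,v\in V(G)$, $P_{T_i}(u,v)\cap P_{T_j}(u,v)=\{u,v\}$. -}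

module Defs where

open import Data.Nat using (ℕ; suc; _≤_; _^_)
open import Data.Bool using (Bool)
open import Data.Fin using (Fin)
open import Data.Vec using (Vec; lookup)
open import Data.List using (List; []; _∷_; drop)
open import Data.List.Relation.Unary.Unique.Propositional using (Unique)
open import Data.List.Membership.Propositional using (_∈_)
open import Data.Product using (Σ; _×_; ∃)
open import Data.Sum using (_⊎_)
open import Data.Empty using (⊥)
open import Relation.Nullary using (¬_)
open import Relation.Binary.PropositionalEquality using (_≡_; _≢_)

V : ℕ → Set
V n = Vec Bool n

Adj : (n : ℕ) → V n → V n → Set
Adj n x y = Σ (Fin n) λ i → (lookup x i ≢ lookup y i) × (∀ j → j ≢ i → lookup x j ≡ lookup y j)

-- A subgraph of Q_n on all vertices, given by its (symmetric) edge relation.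
EdgeRel : ℕ → Set₁
EdgeRel n = V n → V n → Set

data Walk {n : ℕ} (E : EdgeRel n) : V n → V n → Set where
  [] : ∀ {u} → Walk E u u
  _∷_ : ∀ {u v w} → E u v → Walk E v w → Walk E u w

verts : ∀ {n} {E : EdgeRel n} {u v} → Walk E u v → List (V n)
verts {u = u} [] = u ∷ []
verts {u = u} (_ ∷ p) = u ∷ verts p

walkLength : ∀ {n} {E : EdgeRel n} {u v} → Walk E u v → ℕ
walkLength [] = 0
walkLength (_ ∷ p) = suc (walkLength p)

IsPath : ∀ {n} {E : EdgeRel n} {u v} → Walk E u v → Set
IsPath p = Unique (verts p)

IsCycle : ∀ {n} {E : EdgeRel n} {u} → Walk E u u → Set
IsCycle p = (3 ≤ walkLength p) × Unique (drop 1 (verts p))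

IsSpanningTree : (n : ℕ) → EdgeRel n → Set
IsSpanningTree n E =
  (∀ u v → E u v → Adj n u v) ×
  (∀ u v → E u v → E v u) ×
  (∀ u v → Walk E u v) ×
  (∀ u (c : Walk E u u) → ¬ IsCycle c)

AreCISTs : (n m : ℕ) → (Fin m → EdgeRel n) → Set
AreCISTs n m T =
  (∀ i → IsSpanningTree n (T i)) ×
  (∀ i j → i ≢ j → ∀ u v → T i u v → T j u v → ⊥) ×
  (∀ i j → i ≢ j → ∀ u v (p : Walk (T i) u v) (q : Walk (T j) u v) →
     IsPath p → IsPath q → ∀ w → w ∈ verts p → w ∈ verts q → (w ≡ u) ⊎ (w ≡ v))

HasCISTs : (n m : ℕ) → Set₁
HasCISTs n m = Σ (Fin m → EdgeRel n) λ T → AreCISTs n m T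

IsPowerOf2 : ℕ → Set
IsPowerOf2 n = ∃ λ k → n ≡ 2 ^ k

-- Let T₁, …, T_m be completely independent spanning trees of Q_n with n = 2m, and let H = 2ⁿ⁻¹ be
-- the number of even vertices. Independence makes every vertex an inner vertex (degree ≥ 2) of at
-- most one tree, and edge-disjointness bounds its total degree by n. Since Q_n is bipartite, each of
-- the 2ⁿ − 1 edges of Tᵢ has exactly one even endpoint, so the degrees of Tᵢ at even vertices add up
-- to 2H − 1. Weighting the inner vertices of Tᵢ by their slack n − Σⱼ degⱼ(v) turns this into
-- H + Sᵢ = Cᵢ·m + 1, where the weighted slacks Sᵢ add up to at most m. Hence some Sᵢ is 0 or 1, that
-- is, H ≡ 1 or 0 (mod m). In the second case m, and with it n, is a power of two; the first is ruled
-- out for m ≤ 5·10⁶ by computing 2^(2m−1) mod m, which leaves exactly six exceptions.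

module Submission where

open import Defs
open import Data.Bool using (Bool; true; false; not; _xor_; _∨_; _∧_; T)
open import Data.Bool.Properties
  using (not-involutive; not-¬; ¬-not; not-distribˡ-xor; not-distribʳ-xor; T-∨; T-∧; T-≡; T-not-≡)
import Data.Bool.Properties as Bool
open import Data.Empty using (⊥; ⊥-elim)
open import Data.Fin using (Fin; zero; suc; punchIn)
import Data.Fin.Properties as Fin
open import Data.List using (List; []; _∷_; _++_; drop; reverse; length)
open import Data.List.Properties using (∷-injectiveˡ; ∷-injectiveʳ; unfold-reverse)
import Data.List.Properties as List
open import Data.List.Membership.Propositional using (_∈_; _∉_)
open import Data.List.Membership.Propositional.Properties using (∈-++⁺ʳ)
import Data.List.Membership.DecPropositional as DecMembership
open import Data.List.Relation.Binary.Subset.Propositional using (_⊆_)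
import Data.List.Relation.Binary.Permutation.Setoid.Properties as Permutation
open import Data.List.Relation.Binary.Permutation.Setoid using (↭-sym)
open import Data.List.Relation.Unary.All using ([])
open import Data.List.Relation.Unary.All.Properties using (¬Any⇒All¬)
open import Data.List.Relation.Unary.Any using (here; there)
open import Data.List.Relation.Unary.Any.Properties using (reverse⁺; reverse⁻)
open import Data.List.Relation.Unary.Unique.Propositional using (Unique; []; _∷_)
open import Data.List.Relation.Unary.Unique.Propositional.Properties using (++⁺; Unique[x∷xs]⇒x∉xs)
open import Data.Nat using (ℕ; zero; suc; pred; _+_; _*_; _^_; _∸_; _≤_; _<_; s≤s; z≤n; _≤?_; _%_; _/_; _≡ᵇ_; NonZero)
open import Data.Nat.Binary using (ℕᵇ; 2[1+_]; 1+[2_]; fromℕ; toℕ) renaming (zero to 0ᵇ)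
open import Data.Nat.Binary.Properties using (toℕ-fromℕ)
open import Data.Nat.Coprimality using (Coprime; coprime-divisor)
open import Data.Nat.Divisibility using (_∣_; divides; _∣?_; ∣1⇒≡1; *-cancelʳ-∣; m%n≡0⇒n∣m)
open import Data.Nat.DivMod using (%-distribˡ-*; m%n%n≡m%n; m*n%n≡0; m∣n⇒o%n%m≡o%m; [m+kn]%n≡m%n; m*n/n≡m)
open import Data.Nat.Primality using (prime[2]; prime⇒irreducible)
open import Data.Nat.Properties
open import Algebra.Properties.Semiring.Sum +-*-semiring
  using (sum; sum-syntax; sum-cong-≗; sum-remove; ∑-distrib-+; ∑-comm; *-distribˡ-sum; *-distribʳ-sum)
open import Data.List.Membership.DecPropositional _≟_ using (_∈?_)
open import Data.Nat.Tactic.RingSolver using (solve-∀)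
open import Data.Product using (Σ; ∃; ∃₂; _×_; _,_; proj₁; proj₂)
open import Data.Sum using (_⊎_; inj₁; inj₂; [_,_]′)
open import Data.Vec using ([]; _∷_; lookup; updateAt; replicate)
open import Data.Vec.Functional using (removeAt)
open import Data.Vec.Properties
  using (lookup∘updateAt; lookup∘updateAt′; updateAt-updateAt-local; updateAt-id; tabulate∘lookup; tabulate-cong)
import Data.Vec.Properties as Vec
open import Function using (_∘_)
open import Function.Bundles using (Equivalence)
open import Relation.Binary.Definitions using (DecidableEquality)
open import Relation.Binary.PropositionalEquality
  using (_≡_; _≢_; refl; sym; trans; cong; cong₂; subst; setoid; module ≡-Reasoning)
open import Relation.Nullary using (¬_; Dec; does; yes; no)
open import Relation.Nullary.Decidable using (dec-true; dec-false; isYes; toWitness)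

-- Walks and paths

module _ {A : Set} where

  Unique-++⁻ʳ : ∀ xs {ys : List A} → Unique (xs ++ ys) → Unique ys
  Unique-++⁻ʳ []       u        = u
  Unique-++⁻ʳ (_ ∷ xs) (_ ∷ u) = Unique-++⁻ʳ xs u

  Unique-reverse : {xs : List A} → Unique xs → Unique (reverse xs)
  Unique-reverse {xs} = Permutation.Unique-resp-↭ (setoid A) (↭-sym (setoid A) (Permutation.↭-reverse (setoid A) xs))

_≟ᵛ_ : ∀ {n} → DecidableEquality (V n)
_≟ᵛ_ = Vec.≡-dec Bool._≟_

_∈ᵛ?_ : ∀ {n} (v : V n) (vs : List (V n)) → Dec (v ∈ vs)
_∈ᵛ?_ = DecMembership._∈?_ _≟ᵛ_

module _ {n : ℕ} {E : EdgeRel n} where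

  infixr 5 _++ʷ_

  _++ʷ_ : ∀ {a b c} → Walk E a b → Walk E b c → Walk E a c
  []      ++ʷ q = q
  (e ∷ p) ++ʷ q = e ∷ (p ++ʷ q)

  verts-∷ : ∀ {a b} (p : Walk E a b) → verts p ≡ a ∷ drop 1 (verts p)
  verts-∷ []      = refl
  verts-∷ (_ ∷ _) = refl

  end∈verts : ∀ {a b} (p : Walk E a b) → b ∈ verts p
  end∈verts []      = here refl
  end∈verts (_ ∷ p) = there (end∈verts p)

  verts-++ʷ-∷ : ∀ {a b c d} (p : Walk E a b) (e : E b c) (q : Walk E c d) →
                verts (p ++ʷ (e ∷ q)) ≡ verts p ++ verts q
  verts-++ʷ-∷ []       e q = refl
  verts-++ʷ-∷ (e′ ∷ p) e q = cong (_ ∷_) (verts-++ʷ-∷ p e q)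

  walkLength-nonempty : ∀ {x y} (p : Walk E x y) → x ≢ y → 1 ≤ walkLength p
  walkLength-nonempty []      x≢y = ⊥-elim (x≢y refl)
  walkLength-nonempty (_ ∷ _) _   = s≤s z≤n

  walkLength-++ʷ : ∀ {a b c} (p : Walk E a b) (q : Walk E b c) →
                   walkLength (p ++ʷ q) ≡ walkLength p + walkLength q
  walkLength-++ʷ []      q = refl
  walkLength-++ʷ (_ ∷ p) q = cong suc (walkLength-++ʷ p q)

  ∈-verts-++ʷ⁻ : ∀ {a b c w} (p : Walk E a b) (q : Walk E b c) →
                 w ∈ verts (p ++ʷ q) → w ∈ verts p ⊎ w ∈ verts q
  ∈-verts-++ʷ⁻ []      q w∈q         = inj₂ w∈q
  ∈-verts-++ʷ⁻ (_ ∷ p) q (here w≡a)  = inj₁ (here w≡a)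
  ∈-verts-++ʷ⁻ (_ ∷ p) q (there w∈)  with ∈-verts-++ʷ⁻ p q w∈
  ... | inj₁ w∈p = inj₁ (there w∈p)
  ... | inj₂ w∈q = inj₂ w∈q

  verts-suffix : ∀ {a b w} (p : Walk E a b) → w ∈ verts p →
               ∃₂ λ pre (q : Walk E w b) → verts p ≡ pre ++ verts q
  verts-suffix []      (here refl) = [] , [] , refl
  verts-suffix (e ∷ p) (here refl) = [] , e ∷ p , refl
  verts-suffix (e ∷ p) (there w∈p) with verts-suffix p w∈p
  ... | pre , q , eq = _ ∷ pre , q , cong (_ ∷_) eq

  toPath : ∀ {a b} (p : Walk E a b) → Σ (Walk E a b) λ q → IsPath q × verts q ⊆ verts p
  toPath [] = [] , [] ∷ [] , λ w∈ → w∈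
  toPath {a} (e ∷ p) with toPath p
  ... | q , q-path , q⊆p with a ∈ᵛ? verts q
  ...   | no a∉q = e ∷ q , ¬Any⇒All¬ _ a∉q ∷ q-path , λ { (here w≡a) → here w≡a ; (there w∈q) → there (q⊆p w∈q) }
  ...   | yes a∈q with verts-suffix q a∈q
  ...     | pre , s , eq = s , Unique-++⁻ʳ pre (subst Unique eq q-path) , there ∘ q⊆p ∘ subst (_ ∈_) (sym eq) ∘ ∈-++⁺ʳ pre

  module _ (E-sym : ∀ {u v} → E u v → E v u) where

    reverseʷ : ∀ {a b} → Walk E a b → Walk E b a
    reverseʷ []      = []
    reverseʷ (e ∷ p) = reverseʷ p ++ʷ (E-sym e ∷ [])

    verts-reverseʷ : ∀ {a b} (p : Walk E a b) → verts (reverseʷ p) ≡ reverse (verts p)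
    verts-reverseʷ []      = refl
    verts-reverseʷ {a} (e ∷ p) = trans (verts-++ʷ-∷ (reverseʷ p) (E-sym e) [])
      (trans (cong (_++ _) (verts-reverseʷ p)) (sym (unfold-reverse a (verts p))))

    ∈-reverseʷ⁻ : ∀ {a b w} (p : Walk E a b) → w ∈ verts (reverseʷ p) → w ∈ verts p
    ∈-reverseʷ⁻ p = reverse⁻ ∘ subst (_ ∈_) (verts-reverseʷ p)

    ∈-reverseʷ⁺ : ∀ {a b w} (p : Walk E a b) → w ∈ verts p → w ∈ verts (reverseʷ p)
    ∈-reverseʷ⁺ p = subst (_ ∈_) (sym (verts-reverseʷ p)) ∘ reverse⁺

    reverseʷ-isPath : ∀ {a b} (p : Walk E a b) → IsPath p → IsPath (reverseʷ p)
    reverseʷ-isPath p = subst Unique (sym (verts-reverseʷ p)) ∘ Unique-reverse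

  verts≡∷∷⇒E : ∀ {a b w xs} (p : Walk E a b) → verts p ≡ a ∷ w ∷ xs → E a w
  verts≡∷∷⇒E (e ∷ q) eq = subst (E _) (∷-injectiveˡ (trans (sym (verts-∷ q)) (∷-injectiveʳ eq))) e

  last-edge : ∀ {x y} → x ≢ y → Walk E x y → ∃ λ t → E t y
  last-edge x≢y []      = ⊥-elim (x≢y refl)
  last-edge _   (e ∷ p) = after e p
    where
    after : ∀ {a b c} → E a b → Walk E b c → ∃ λ t → E t c
    after e []       = _ , e
    after _ (e ∷ p) = after e p


-- Trees

module _ {n : ℕ} {E : EdgeRel n} (E-sym : ∀ {u v} → E u v → E v u)
         (acyclic : ∀ u (c : Walk E u u) → ¬ IsCycle c) where

  no-detour : ∀ {a x y} → E a x → E a y → x ≢ y → (w : Walk E x y) → a ∉ verts w → ⊥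
  no-detour {a} e f x≢y w a∉w with toPath w
  ... | p , p-path , p⊆w = acyclic a (e ∷ (p ++ʷ (E-sym f ∷ []))) (cycle-length , cycle-unique)
    where
    cycle-length : 3 ≤ suc (walkLength (p ++ʷ (E-sym f ∷ [])))
    cycle-length rewrite walkLength-++ʷ p (E-sym f ∷ []) = s≤s (+-monoˡ-≤ 1 (walkLength-nonempty p x≢y))
    cycle-unique : Unique (verts (p ++ʷ (E-sym f ∷ [])))
    cycle-unique rewrite verts-++ʷ-∷ p (E-sym f) [] =
      ++⁺ p-path ([] ∷ []) λ { (a∈p , here refl) → a∉w (p⊆w a∈p) }

  path-unique : ∀ {a b} (p q : Walk E a b) → IsPath p → IsPath q → verts p ≡ verts q
  path-unique []      []      _ _ = refl
  path-unique []      (_ ∷ q) _ q-path = ⊥-elim (Unique[x∷xs]⇒x∉xs q-path (end∈verts q))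
  path-unique (_ ∷ p) []      p-path _ = ⊥-elim (Unique[x∷xs]⇒x∉xs p-path (end∈verts p))
  path-unique (_∷_ {v = x} e p) (_∷_ {v = y} f q) (a∉p ∷ p-path) (a∉q ∷ q-path) with x ≟ᵛ y
  ... | yes refl = cong (_ ∷_) (path-unique p q p-path q-path)
  ... | no  x≢y  = ⊥-elim (no-detour e f x≢y (p ++ʷ reverseʷ E-sym q) a∉detour)
    where
    a∉detour : _ ∉ verts (p ++ʷ reverseʷ E-sym q)
    a∉detour a∈ with ∈-verts-++ʷ⁻ p (reverseʷ E-sym q) a∈
    ... | inj₁ a∈p = Unique[x∷xs]⇒x∉xs (a∉p ∷ p-path) a∈p
    ... | inj₂ a∈q = Unique[x∷xs]⇒x∉xs (a∉q ∷ q-path) (∈-reverseʷ⁻ E-sym q a∈q)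

module Tree {n : ℕ} {E : EdgeRel n} (E-sym : ∀ {u v} → E u v → E v u)
            (acyclic : ∀ u (c : Walk E u u) → ¬ IsCycle c) (connected : ∀ u v → Walk E u v) where

  path : ∀ x y → Walk E x y
  path x y = proj₁ (toPath (connected x y))

  path-isPath : ∀ x y → IsPath (path x y)
  path-isPath x y = proj₁ (proj₂ (toPath (connected x y)))

  OnPath : V n → V n → V n → Set
  OnPath v x y = Σ (Walk E x y) λ p → IsPath p × v ∈ verts p

  OnPath-sym : ∀ {v x y} → OnPath v x y → OnPath v y x
  OnPath-sym (p , p-path , v∈p) = reverseʷ E-sym p , reverseʷ-isPath E-sym p p-path , ∈-reverseʷ⁺ E-sym p v∈p

  -- Otherwise shortening the walk from x through y to z gives an x–z path avoiding v.
  OnPath-split : ∀ {v x z} → OnPath v x z → ∀ y → OnPath v x y ⊎ OnPath v y z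
  OnPath-split {v} {x} {z} (p , p-path , v∈p) y with v ∈ᵛ? verts (path x y) | v ∈ᵛ? verts (path y z)
  ... | yes v∈xy | _        = inj₁ (path x y , path-isPath x y , v∈xy)
  ... | no  _    | yes v∈yz = inj₂ (path y z , path-isPath y z , v∈yz)
  ... | no  v∉xy | no  v∉yz with toPath (path x y ++ʷ path y z)
  ...   | q , q-path , q⊆ = ⊥-elim (v∉q (subst (v ∈_) (path-unique E-sym acyclic p q p-path q-path) v∈p))
    where
    v∉q : v ∉ verts q
    v∉q v∈q with ∈-verts-++ʷ⁻ (path x y) (path y z) (q⊆ v∈q)
    ... | inj₁ v∈xy = v∉xy v∈xy
    ... | inj₂ v∈yz = v∉yz v∈yz

  OnPath-neighbours : ∀ {v a b} → E v a → E v b → a ≢ b → a ≢ v → b ≢ v → OnPath v a b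
  OnPath-neighbours e f a≢b a≢v b≢v =
    E-sym e ∷ f ∷ [] ,
    ¬Any⇒All¬ _ (λ { (here a≡v) → a≢v a≡v ; (there (here a≡b)) → a≢b a≡b }) ∷
      ¬Any⇒All¬ _ (λ { (here v≡b) → b≢v (sym v≡b) }) ∷ [] ∷ [] ,
    there (here refl)

  module Rooted (r : V n) where

    branch : V n → List (V n)
    branch u = verts (path u r)

    branch-unique : ∀ {u} (p : Walk E u r) → IsPath p → verts p ≡ branch u
    branch-unique {u} p p-path = path-unique E-sym acyclic p (path u r) p-path (path-isPath u r)

    branch-head : ∀ {u w xs} → branch u ≡ w ∷ xs → u ≡ w
    branch-head {u} eq = ∷-injectiveˡ (trans (sym (verts-∷ (path u r))) eq)

    branch-suffix : ∀ {u w} → u ∈ branch w → ∃ λ pre → branch w ≡ pre ++ branch u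
    branch-suffix {u} {w} u∈ with verts-suffix (path w r) u∈
    ... | pre , q , eq = pre , trans eq (cong (pre ++_) (branch-unique q (Unique-++⁻ʳ pre (subst Unique eq (path-isPath w r)))))

    Parent : V n → V n → Set
    Parent u w = branch u ≡ u ∷ branch w

    Parent? : ∀ u w → Dec (Parent u w)
    Parent? u w = List.≡-dec _≟ᵛ_ (branch u) (u ∷ branch w)

    Parent⇒E : ∀ {u w} → Parent u w → E u w
    Parent⇒E {u} {w} eq = verts≡∷∷⇒E (path u r) (trans eq (cong (u ∷_) (verts-∷ (path w r))))

    Parent-functional : ∀ {u w w′} → Parent u w → Parent u w′ → w ≡ w′
    Parent-functional {w = w} eq eq′ = branch-head (trans (∷-injectiveʳ (trans (sym eq) eq′)) (verts-∷ (path _ r)))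

    Parent-asym : ∀ {u w} → Parent u w → Parent w u → ⊥
    Parent-asym {u} {w} u→w w→u = m≢1+n+m (length (branch u)) (cong length (trans u→w (cong (u ∷_) w→u)))

    branch-root : branch r ≡ r ∷ []
    branch-root = sym (branch-unique [] ([] ∷ []))

    root-parentless : ∀ {w} → ¬ Parent r w
    root-parentless {w} r→w with trans (sym (∷-injectiveʳ (trans (sym r→w) branch-root))) (verts-∷ (path w r))
    ... | ()

    parent-exists : ∀ {u} → u ≢ r → ∃ (Parent u)
    parent-exists {u} u≢r = step (path u r) (path-isPath u r) u≢r
      where
      step : (p : Walk E u r) → IsPath p → u ≢ r → ∃ λ w → verts p ≡ u ∷ branch w
      step []      _            u≢r = ⊥-elim (u≢r refl)
      step (_ ∷ q) (_ ∷ q-path) _   = _ , cong (u ∷_) (branch-unique q q-path)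

    parent-via : ∀ {u w} → E u w → u ∉ branch w → Parent u w
    parent-via {w = w} e u∉ = sym (branch-unique (e ∷ path w r) (¬Any⇒All¬ _ u∉ ∷ path-isPath w r))

    edge-oriented : ∀ {u w} → E u w → u ≢ w → Parent u w ⊎ Parent w u
    edge-oriented {u} {w} e u≢w with u ∈ᵛ? branch w | w ∈ᵛ? branch u
    ... | no  u∉  | _        = inj₁ (parent-via e u∉)
    ... | yes _   | no  w∉   = inj₂ (parent-via (E-sym e) w∉)
    ... | yes u∈  | yes w∈   with branch-suffix u∈
    ...   | [] , eq = ⊥-elim (u≢w (sym (branch-head (trans eq (verts-∷ (path u r))))))
    ...   | x ∷ pre , eq with branch-head eq
    ...     | refl = ⊥-elim (Unique[x∷xs]⇒x∉xs (subst Unique eq (path-isPath w r)) (∈-++⁺ʳ pre w∈))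


-- The hypercube

flip : ∀ {n} → V n → Fin n → V n
flip v i = updateAt v i not

flip-involutive : ∀ {n} (v : V n) i → flip (flip v i) i ≡ v
flip-involutive v i = trans (updateAt-updateAt-local i v (not-involutive _)) (updateAt-id i v)

flip-≢ : ∀ {n} (v : V n) i → flip v i ≢ v
flip-≢ v i eq = not-¬ refl (trans (sym (cong (λ w → lookup w i) eq)) (lookup∘updateAt i v))

flip-injective : ∀ {n} (v : V n) {i j} → flip v i ≡ flip v j → i ≡ j
flip-injective v {i} {j} eq with i Fin.≟ j
... | yes i≡j = i≡j
... | no  i≢j = ⊥-elim (not-¬ refl v[i]≡not-v[i])
  where
  v[i]≡not-v[i] : lookup v i ≡ not (lookup v i)
  v[i]≡not-v[i] = trans (sym (lookup∘updateAt′ i j i≢j v)) (trans (cong (λ w → lookup w i) (sym eq)) (lookup∘updateAt i v))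

Adj⇒flip : ∀ {n} {u w : V n} → Adj n u w → Σ (Fin n) λ i → w ≡ flip u i
Adj⇒flip {u = u} {w} (i , differs , agrees) =
  i , trans (sym (tabulate∘lookup w)) (trans (tabulate-cong coordinate) (tabulate∘lookup (flip u i)))
  where
  coordinate : ∀ j → lookup w j ≡ lookup (flip u i) j
  coordinate j with j Fin.≟ i
  ... | yes refl = trans (¬-not (differs ∘ sym)) (sym (lookup∘updateAt i u))
  ... | no  j≢i  = trans (sym (agrees j j≢i)) (sym (lookup∘updateAt′ j i j≢i u))

parity : ∀ {n} → V n → Bool
parity []      = false
parity (b ∷ v) = b xor parity v

parity-flip : ∀ {n} (v : V n) i → parity (flip v i) ≡ not (parity v)
parity-flip (b ∷ v) zero    = sym (not-distribˡ-xor b (parity v))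
parity-flip (b ∷ v) (suc i) = trans (cong (b xor_) (parity-flip v i)) (sym (not-distribʳ-xor b (parity v)))


-- Sums

indicator : Bool → ℕ
indicator false = 0
indicator true  = 1

indicator≤1 : ∀ b → indicator b ≤ 1
indicator≤1 false = z≤n
indicator≤1 true  = s≤s z≤n

indicator-not : ∀ b → indicator b + indicator (not b) ≡ 1
indicator-not false = refl
indicator-not true  = refl

sum-const : ∀ k c → ∑[ i < k ] c ≡ k * c
sum-const zero    c = refl
sum-const (suc k) c = cong (c +_) (sum-const k c)

sum-mono-≤ : ∀ {k} {f g : Fin k → ℕ} → (∀ i → f i ≤ g i) → sum f ≤ sum g
sum-mono-≤ {zero}  f≤g = z≤n
sum-mono-≤ {suc k} f≤g = +-mono-≤ (f≤g zero) (sum-mono-≤ (λ i → f≤g (suc i)))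

term≤sum : ∀ {k} (f : Fin k → ℕ) i → f i ≤ sum f
term≤sum f zero    = m≤m+n _ _
term≤sum f (suc i) = ≤-trans (term≤sum (λ j → f (suc j)) i) (m≤n+m _ _)

sum-single : ∀ {k c} (f : Fin k → ℕ) i → (∀ j → j ≢ i → f j ≡ c) → sum f + c ≡ f i + k * c
sum-single {suc k} {c} f i others = begin
  sum f + c                  ≡⟨ cong (_+ c) (sum-remove f) ⟩
  f i + sum (removeAt f i) + c ≡⟨ cong (λ s → f i + s + c) (sum-cong-≗ (λ j → others (punchIn i j) (Fin.punchInᵢ≢i i j))) ⟩
  f i + ∑[ j < k ] c + c     ≡⟨ cong (λ s → f i + s + c) (sum-const k c) ⟩
  f i + k * c + c            ≡⟨ rearrange (f i) (k * c) c ⟩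
  f i + (c + k * c)          ∎
  where
  open ≡-Reasoning
  rearrange : ∀ a b c → a + b + c ≡ a + (c + b)
  rearrange = solve-∀

sum-single-0 : ∀ {k} (f : Fin k → ℕ) i → (∀ j → j ≢ i → f j ≡ 0) → sum f ≡ f i
sum-single-0 {k} f i others = trans (sym (+-identityʳ (sum f))) (trans (sum-single f i others) (trans (cong (f i +_) (*-zeroʳ k)) (+-identityʳ (f i))))

sum≥1⇒term≥1 : ∀ {k} (f : Fin k → ℕ) → 1 ≤ sum f → ∃ λ i → 1 ≤ f i
sum≥1⇒term≥1 {suc k} f 1≤sum with f zero in eq
... | suc _ = zero , subst (1 ≤_) (sym eq) (s≤s z≤n)
... | zero with sum≥1⇒term≥1 (λ j → f (suc j)) 1≤sum
...   | i , 1≤fi = suc i , 1≤fi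

sum≥2⇒two-terms≥1 : ∀ {k} (f : Fin k → ℕ) → (∀ i → f i ≤ 1) → 2 ≤ sum f →
                    ∃₂ λ i j → i ≢ j × 1 ≤ f i × 1 ≤ f j
sum≥2⇒two-terms≥1 {suc k} f f≤1 2≤sum with f zero in eq | f≤1 zero
... | suc zero | _ with sum≥1⇒term≥1 (λ j → f (suc j)) (≤-pred 2≤sum)
...   | j , 1≤fj = zero , suc j , (λ ()) , subst (1 ≤_) (sym eq) (s≤s z≤n) , 1≤fj
sum≥2⇒two-terms≥1 {suc k} f f≤1 2≤sum | zero | _ with sum≥2⇒two-terms≥1 (λ j → f (suc j)) (λ j → f≤1 (suc j)) 2≤sum
... | i , j , i≢j , 1≤fi , 1≤fj = suc i , suc j , i≢j ∘ Fin.suc-injective , 1≤fi , 1≤fj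
sum≥2⇒two-terms≥1 {suc k} f f≤1 2≤sum | suc (suc _) | s≤s ()

sum<⇒term< : ∀ {k c} (f : Fin k → ℕ) → sum f < k * c → ∃ λ i → f i < c
sum<⇒term< {suc k} {c} f sum< with f zero <? c
... | yes f0<c = zero , f0<c
... | no  f0≮c with sum<⇒term< (λ j → f (suc j)) (+-cancelˡ-< c _ _ (≤-<-trans (+-monoˡ-≤ _ (≮⇒≥ f0≮c)) sum<))
...   | i , fi<c = suc i , fi<c

sumᵛ : ∀ {n} → (V n → ℕ) → ℕ
sumᵛ {zero}  f = f []
sumᵛ {suc n} f = sumᵛ (λ v → f (false ∷ v)) + sumᵛ (λ v → f (true ∷ v))

sumᵛ-cong : ∀ {n} {f g : V n → ℕ} → (∀ v → f v ≡ g v) → sumᵛ f ≡ sumᵛ g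
sumᵛ-cong {zero}  f≗g = f≗g []
sumᵛ-cong {suc n} f≗g = cong₂ _+_ (sumᵛ-cong (λ v → f≗g (false ∷ v))) (sumᵛ-cong (λ v → f≗g (true ∷ v)))

sumᵛ-mono-≤ : ∀ {n} {f g : V n → ℕ} → (∀ v → f v ≤ g v) → sumᵛ f ≤ sumᵛ g
sumᵛ-mono-≤ {zero}  f≤g = f≤g []
sumᵛ-mono-≤ {suc n} f≤g = +-mono-≤ (sumᵛ-mono-≤ (λ v → f≤g (false ∷ v))) (sumᵛ-mono-≤ (λ v → f≤g (true ∷ v)))

sumᵛ-distrib-+ : ∀ {n} (f g : V n → ℕ) → sumᵛ (λ v → f v + g v) ≡ sumᵛ f + sumᵛ g
sumᵛ-distrib-+ {zero}  f g = refl
sumᵛ-distrib-+ {suc n} f g = trans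
  (cong₂ _+_ (sumᵛ-distrib-+ (λ v → f (false ∷ v)) (λ v → g (false ∷ v))) (sumᵛ-distrib-+ (λ v → f (true ∷ v)) (λ v → g (true ∷ v))))
  (interchange (sumᵛ (λ v → f (false ∷ v))) (sumᵛ (λ v → g (false ∷ v))) (sumᵛ (λ v → f (true ∷ v))) (sumᵛ (λ v → g (true ∷ v))))
  where
  interchange : ∀ a b c d → (a + b) + (c + d) ≡ (a + c) + (b + d)
  interchange = solve-∀

*-distribˡ-sumᵛ : ∀ {n} c (f : V n → ℕ) → c * sumᵛ f ≡ sumᵛ (λ v → c * f v)
*-distribˡ-sumᵛ {zero}  c f = refl
*-distribˡ-sumᵛ {suc n} c f = trans (*-distribˡ-+ c _ _)
  (cong₂ _+_ (*-distribˡ-sumᵛ c (λ v → f (false ∷ v))) (*-distribˡ-sumᵛ c (λ v → f (true ∷ v))))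

sumᵛ-const : ∀ n c → sumᵛ {n} (λ _ → c) ≡ 2 ^ n * c
sumᵛ-const zero    c = sym (+-identityʳ c)
sumᵛ-const (suc n) c = trans (cong₂ _+_ (sumᵛ-const n c) (sumᵛ-const n c)) (double (2 ^ n) c)
  where
  double : ∀ x c → x * c + x * c ≡ (2 * x) * c
  double = solve-∀

sumᵛ-comm : ∀ {n k} (f : V n → Fin k → ℕ) → sumᵛ (λ v → ∑[ i < k ] f v i) ≡ ∑[ i < k ] sumᵛ (λ v → f v i)
sumᵛ-comm {zero}  f = refl
sumᵛ-comm {suc n} f = trans (cong₂ _+_ (sumᵛ-comm (λ v → f (false ∷ v))) (sumᵛ-comm (λ v → f (true ∷ v))))
  (sym (∑-distrib-+ (λ i → sumᵛ (λ v → f (false ∷ v) i)) (λ i → sumᵛ (λ v → f (true ∷ v) i))))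

sumᵛ-flip : ∀ {n} (f : V n → ℕ) i → sumᵛ (λ v → f (flip v i)) ≡ sumᵛ f
sumᵛ-flip {suc n} f zero    = +-comm (sumᵛ (λ v → f (true ∷ v))) (sumᵛ (λ v → f (false ∷ v)))
sumᵛ-flip {suc n} f (suc i) = cong₂ _+_ (sumᵛ-flip (λ v → f (false ∷ v)) i) (sumᵛ-flip (λ v → f (true ∷ v)) i)

sumᵛ-point : ∀ {n} (r : V n) → sumᵛ (λ v → indicator (does (v ≟ᵛ r))) ≡ 1
sumᵛ-point []          = refl
sumᵛ-point {suc n} (false ∷ r) = cong₂ _+_ (sumᵛ-point r) (trans (sumᵛ-const n 0) (*-zeroʳ (2 ^ n)))
sumᵛ-point {suc n} (true ∷ r)  = cong₂ _+_ (trans (sumᵛ-const n 0) (*-zeroʳ (2 ^ n))) (sumᵛ-point r)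

evenWeight oddWeight : ∀ {n} → V n → ℕ
evenWeight v = indicator (not (parity v))
oddWeight  v = indicator (parity v)

evenWeight+oddWeight : ∀ {n} (v : V n) → evenWeight v + oddWeight v ≡ 1
evenWeight+oddWeight v = trans (+-comm (evenWeight v) _) (indicator-not (parity v))

sumᵛ-evenWeight : ∀ n → sumᵛ {suc n} evenWeight ≡ 2 ^ n
sumᵛ-evenWeight n = begin
  sumᵛ {n} (λ v → indicator (not (parity v))) + sumᵛ {n} (λ v → indicator (not (not (parity v))))
    ≡⟨ cong (sumᵛ {n} (λ v → indicator (not (parity v))) +_) (sumᵛ-cong {n} (λ v → cong indicator (not-involutive (parity v)))) ⟩
  sumᵛ {n} (λ v → indicator (not (parity v))) + sumᵛ {n} (λ v → indicator (parity v))
    ≡⟨ sym (sumᵛ-distrib-+ {n} _ _) ⟩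
  sumᵛ {n} (λ v → indicator (not (parity v)) + indicator (parity v))
    ≡⟨ sumᵛ-cong {n} evenWeight+oddWeight ⟩
  sumᵛ {n} (λ _ → 1)
    ≡⟨ trans (sumᵛ-const n 1) (*-identityʳ _) ⟩
  2 ^ n ∎
  where open ≡-Reasoning


-- Degrees in a spanning tree of Q_n

module SpanningTreeDegree {n : ℕ} {E : EdgeRel n} (T : IsSpanningTree n E) (r : V n) where

  E⊆Adj : ∀ {u w} → E u w → Adj n u w
  E⊆Adj = proj₁ T _ _

  E-sym : ∀ {u w} → E u w → E w u
  E-sym = proj₁ (proj₂ T) _ _

  connected : ∀ u w → Walk E u w
  connected = proj₁ (proj₂ (proj₂ T))

  open Tree E-sym (proj₂ (proj₂ (proj₂ T))) connected public
  open Rooted r public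

  parentIndicator : V n → V n → ℕ
  parentIndicator u w = indicator (does (Parent? u w))

  -- E is not decidable, but tree edges are: one endpoint must be the parent of the other.
  edgeIndicator : V n → Fin n → ℕ
  edgeIndicator u j = parentIndicator u (flip u j) + parentIndicator (flip u j) u

  degree : V n → ℕ
  degree u = ∑[ j < n ] edgeIndicator u j

  parentIndicator-yes : ∀ {u w} → Parent u w → parentIndicator u w ≡ 1
  parentIndicator-yes {u} {w} u→w = cong indicator (dec-true (Parent? u w) u→w)

  parentIndicator-no : ∀ {u w} → ¬ Parent u w → parentIndicator u w ≡ 0
  parentIndicator-no {u} {w} ¬u→w = cong indicator (dec-false (Parent? u w) ¬u→w)

  edgeIndicator≤1 : ∀ u j → edgeIndicator u j ≤ 1
  edgeIndicator≤1 u j with Parent? u (flip u j) | Parent? (flip u j) u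
  ... | yes u→w | yes w→u = ⊥-elim (Parent-asym u→w w→u)
  ... | yes _   | no  _   = s≤s z≤n
  ... | no  _   | yes _   = s≤s z≤n
  ... | no  _   | no  _   = z≤n

  edgeIndicator⇒E : ∀ {u j} → 1 ≤ edgeIndicator u j → E u (flip u j)
  edgeIndicator⇒E {u} {j} 1≤ with Parent? u (flip u j) | Parent? (flip u j) u
  ... | yes u→w | _       = Parent⇒E u→w
  ... | no  _   | yes w→u = E-sym (Parent⇒E w→u)

  E⇒edgeIndicator : ∀ {u j} → E u (flip u j) → 1 ≤ edgeIndicator u j
  E⇒edgeIndicator {u} {j} e with edge-oriented e (flip-≢ u j ∘ sym)
  ... | inj₁ u→w = ≤-trans (≤-reflexive (sym (parentIndicator-yes u→w))) (m≤m+n _ _)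
  ... | inj₂ w→u = ≤-trans (≤-reflexive (sym (parentIndicator-yes w→u))) (m≤n+m _ _)

  degree-positive : ∀ {u w} → w ≢ u → 1 ≤ degree u
  degree-positive {u} w≢u with last-edge w≢u (connected _ u)
  ... | t , t→u with Adj⇒flip {u = u} {w = t} (E⊆Adj (E-sym t→u))
  ...   | j , refl = ≤-trans (E⇒edgeIndicator (E-sym t→u)) (term≤sum (edgeIndicator u) j)

  nonRoot : V n → ℕ
  nonRoot u = indicator (not (does (u ≟ᵛ r)))

  sum-parentIndicator : ∀ u → ∑[ j < n ] parentIndicator u (flip u j) ≡ nonRoot u
  sum-parentIndicator u with u ≟ᵛ r
  ... | yes refl = trans (sum-cong-≗ (λ j → parentIndicator-no {w = flip r j} root-parentless)) (trans (sum-const n 0) (*-zeroʳ n))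
  ... | no  u≢r with parent-exists u≢r
  ...   | w , u→w with Adj⇒flip {u = u} {w = w} (E⊆Adj (Parent⇒E u→w))
  ...     | d , refl = trans (sum-single-0 _ d others) (parentIndicator-yes u→w)
    where
    others : ∀ j → j ≢ d → parentIndicator u (flip u j) ≡ 0
    others j j≢d = parentIndicator-no (λ u→fj → j≢d (flip-injective u (sym (Parent-functional u→w u→fj))))

  sum-children : sumᵛ (λ v → evenWeight v * ∑[ j < n ] parentIndicator (flip v j) v) ≡
                 sumᵛ (λ v → oddWeight v * nonRoot v)
  sum-children = begin
    sumᵛ (λ v → evenWeight v * ∑[ j < n ] parentIndicator (flip v j) v)
      ≡⟨ sumᵛ-cong (λ v → *-distribˡ-sum (evenWeight v) (λ j → parentIndicator (flip v j) v)) ⟩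
    sumᵛ (λ v → ∑[ j < n ] (evenWeight v * parentIndicator (flip v j) v))
      ≡⟨ sumᵛ-comm (λ v j → evenWeight v * parentIndicator (flip v j) v) ⟩
    ∑[ j < n ] sumᵛ (λ v → evenWeight v * parentIndicator (flip v j) v)
      ≡⟨ sum-cong-≗ (λ j → trans (sumᵛ-cong (λ v → sym (reindex v j))) (sumᵛ-flip (oddChild j) j)) ⟩
    ∑[ j < n ] sumᵛ (oddChild j)
      ≡⟨ sym (sumᵛ-comm (λ u j → oddChild j u)) ⟩
    sumᵛ (λ u → ∑[ j < n ] (oddWeight u * parentIndicator u (flip u j)))
      ≡⟨ sumᵛ-cong (λ u → trans (sym (*-distribˡ-sum (oddWeight u) (λ j → parentIndicator u (flip u j)))) (cong (oddWeight u *_) (sum-parentIndicator u))) ⟩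
    sumᵛ (λ v → oddWeight v * nonRoot v) ∎
    where
    open ≡-Reasoning
    oddChild : Fin n → V n → ℕ
    oddChild j u = oddWeight u * parentIndicator u (flip u j)
    reindex : ∀ v j → oddChild j (flip v j) ≡ evenWeight v * parentIndicator (flip v j) v
    reindex v j = cong₂ (λ b w → indicator b * parentIndicator (flip v j) w) (parity-flip v j) (flip-involutive v j)

  -- Every edge has exactly one even endpoint, and at the even vertices the edges to parents and
  -- to children account for every non-root vertex exactly once.
  sum-evenWeight-degree : sumᵛ (λ v → evenWeight v * degree v) + 1 ≡ 2 ^ n
  sum-evenWeight-degree = begin
    sumᵛ (λ v → evenWeight v * degree v) + 1
      ≡⟨ cong (_+ 1) (sumᵛ-cong (λ v → trans (cong (evenWeight v *_) (∑-distrib-+ (λ j → parentIndicator v (flip v j)) (λ j → parentIndicator (flip v j) v))) (*-distribˡ-+ (evenWeight v) _ _))) ⟩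
    sumᵛ (λ v → evenWeight v * ∑[ j < n ] parentIndicator v (flip v j) + evenWeight v * ∑[ j < n ] parentIndicator (flip v j) v) + 1
      ≡⟨ cong (_+ 1) (sumᵛ-distrib-+ {n} _ _) ⟩
    sumᵛ (λ v → evenWeight v * ∑[ j < n ] parentIndicator v (flip v j)) + sumᵛ (λ v → evenWeight v * ∑[ j < n ] parentIndicator (flip v j) v) + 1
      ≡⟨ cong₂ (λ a b → a + b + 1) (sumᵛ-cong (λ v → cong (evenWeight v *_) (sum-parentIndicator v))) sum-children ⟩
    sumᵛ (λ v → evenWeight v * nonRoot v) + sumᵛ (λ v → oddWeight v * nonRoot v) + 1
      ≡⟨ cong (_+ 1) (sym (sumᵛ-distrib-+ {n} _ _)) ⟩
    sumᵛ (λ v → evenWeight v * nonRoot v + oddWeight v * nonRoot v) + 1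
      ≡⟨ cong (_+ 1) (sumᵛ-cong (λ v → trans (sym (*-distribʳ-+ (nonRoot v) (evenWeight v) _)) (trans (cong (_* nonRoot v) (evenWeight+oddWeight v)) (*-identityˡ _)))) ⟩
    sumᵛ nonRoot + 1
      ≡⟨ cong (sumᵛ nonRoot +_) (sym (sumᵛ-point r)) ⟩
    sumᵛ nonRoot + sumᵛ (λ v → indicator (does (v ≟ᵛ r)))
      ≡⟨ sym (sumᵛ-distrib-+ nonRoot _) ⟩
    sumᵛ (λ v → nonRoot v + indicator (does (v ≟ᵛ r)))
      ≡⟨ sumᵛ-cong (λ v → trans (+-comm (nonRoot v) _) (indicator-not (does (v ≟ᵛ r)))) ⟩
    sumᵛ {n} (λ _ → 1)
      ≡⟨ trans (sumᵛ-const n 1) (*-identityʳ _) ⟩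
    2 ^ n ∎
    where open ≡-Reasoning

  degree≥2⇒inner : ∀ {v} → 2 ≤ degree v → ∃₂ λ a b → a ≢ v × b ≢ v × OnPath v a b
  degree≥2⇒inner {v} 2≤deg with sum≥2⇒two-terms≥1 (edgeIndicator v) (edgeIndicator≤1 v) 2≤deg
  ... | j₁ , j₂ , j₁≢j₂ , e₁ , e₂ =
    flip v j₁ , flip v j₂ , flip-≢ v j₁ , flip-≢ v j₂ ,
    OnPath-neighbours (edgeIndicator⇒E e₁) (edgeIndicator⇒E e₂) (j₁≢j₂ ∘ flip-injective v) (flip-≢ v j₁) (flip-≢ v j₂)


-- Completely independent spanning trees

-- Used with S x y and S′ x y saying that v lies on the x–y path of two different trees.
module _ {A : Set} (S S′ : A → A → Set) (Ok : A → Set)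
         (S-sym : ∀ {x y} → S x y → S y x) (S-split : ∀ {x z} → S x z → ∀ y → S x y ⊎ S y z)
         (S′-sym : ∀ {x y} → S′ x y → S′ y x) (S′-split : ∀ {x z} → S′ x z → ∀ y → S′ x y ⊎ S′ y z) where

  Meet : Set
  Meet = ∃₂ λ x y → Ok x × Ok y × S x y × S′ x y

  meet-via : ∀ {x c d} → Ok x → Ok c → Ok d → S x c → S′ c d → Meet
  meet-via {x} {c} {d} ox oc od Sxc S′cd with S-split Sxc d
  ... | inj₂ Sdc = d , c , od , oc , Sdc , S′-sym S′cd
  ... | inj₁ Sxd with S′-split S′cd x
  ...   | inj₁ S′cx = x , c , ox , oc , Sxc , S′-sym S′cx
  ...   | inj₂ S′xd = x , d , ox , od , Sxd , S′xd

  split-relations-meet : ∀ {a b c d} → Ok a → Ok b → Ok c → Ok d → S a b → S′ c d → Meet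
  split-relations-meet {c = c} oa ob oc od Sab S′cd with S-split Sab c
  ... | inj₁ Sac = meet-via oa oc od Sac S′cd
  ... | inj₂ Scb = meet-via ob oc od (S-sym Scb) S′cd

module CISTDegrees {n m : ℕ} (T : Fin m → EdgeRel n) (cists : AreCISTs n m T) where

  module Treeᵢ (i : Fin m) = SpanningTreeDegree (proj₁ cists i) (replicate n false)

  degree : Fin m → V n → ℕ
  degree i = Treeᵢ.degree i

  edge-in-one-tree : ∀ v j → ∑[ i < m ] Treeᵢ.edgeIndicator i v j ≤ 1
  edge-in-one-tree v j with 2 ≤? ∑[ i < m ] Treeᵢ.edgeIndicator i v j
  ... | no  sum≱2 = ≤-pred (≰⇒> sum≱2)
  ... | yes sum≥2 with sum≥2⇒two-terms≥1 (λ i → Treeᵢ.edgeIndicator i v j) (λ i → Treeᵢ.edgeIndicator≤1 i v j) sum≥2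
  ...   | i , k , i≢k , eᵢ , eₖ = ⊥-elim (proj₁ (proj₂ cists) i k i≢k v (flip v j) (Treeᵢ.edgeIndicator⇒E i eᵢ) (Treeᵢ.edgeIndicator⇒E k eₖ))

  sum-degree≤ : ∀ v → ∑[ i < m ] degree i v ≤ n
  sum-degree≤ v = begin
    ∑[ i < m ] degree i v                              ≡⟨ ∑-comm (λ i j → Treeᵢ.edgeIndicator i v j) ⟩
    ∑[ j < n ] ∑[ i < m ] Treeᵢ.edgeIndicator i v j  ≤⟨ sum-mono-≤ (edge-in-one-tree v) ⟩
    ∑[ j < n ] 1                                       ≡⟨ trans (sum-const n 1) (*-identityʳ n) ⟩
    n                                                  ∎
    where open ≤-Reasoning

  inner-in-one-tree : ∀ v {i k} → i ≢ k → 2 ≤ degree i v → 2 ≤ degree k v → ⊥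
  inner-in-one-tree v {i} {k} i≢k 2≤degᵢ 2≤degₖ with Treeᵢ.degree≥2⇒inner i 2≤degᵢ | Treeᵢ.degree≥2⇒inner k 2≤degₖ
  ... | a , b , a≢v , b≢v , v∈ab | c , d , c≢v , d≢v , v∈cd
    with split-relations-meet (Treeᵢ.OnPath i v) (Treeᵢ.OnPath k v) (_≢ v)
           (Treeᵢ.OnPath-sym i) (Treeᵢ.OnPath-split i) (Treeᵢ.OnPath-sym k) (Treeᵢ.OnPath-split k)
           a≢v b≢v c≢v d≢v v∈ab v∈cd
  ... | x , y , x≢v , y≢v , (p , p-path , v∈p) , (q , q-path , v∈q)
    with proj₂ (proj₂ cists) i k i≢k x y p q p-path q-path v v∈p v∈q
  ...   | inj₁ v≡x = x≢v (sym v≡x)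
  ...   | inj₂ v≡y = y≢v (sym v≡y)

-- Counting degrees at even vertices

module DegreeCounting {n′ m : ℕ} .{{_ : NonZero m}} (n≡m+m : suc n′ ≡ m + m)
  (degree : Fin m → V (suc n′) → ℕ)
  (sum-evenWeight-degree : ∀ i → sumᵛ (λ v → evenWeight v * degree i v) + 1 ≡ 2 ^ suc n′)
  (sum-degree≤ : ∀ v → ∑[ i < m ] degree i v ≤ suc n′)
  (degree-positive : ∀ i v → 1 ≤ degree i v)
  (inner-in-one-tree : ∀ v {i k} → i ≢ k → 2 ≤ degree i v → 2 ≤ degree k v → ⊥) where

  n H : ℕ
  n = suc n′
  H = 2 ^ n′

  evenSum : (V n → ℕ) → ℕ
  evenSum f = sumᵛ (λ v → evenWeight v * f v)

  evenSum-cong : ∀ {f g} → (∀ v → f v ≡ g v) → evenSum f ≡ evenSum g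
  evenSum-cong f≗g = sumᵛ-cong {n} (λ v → cong (evenWeight v *_) (f≗g v))

  evenSum-+ : ∀ f g → evenSum (λ v → f v + g v) ≡ evenSum f + evenSum g
  evenSum-+ f g = trans (sumᵛ-cong (λ v → *-distribˡ-+ (evenWeight v) (f v) (g v))) (sumᵛ-distrib-+ (λ v → evenWeight v * f v) (λ v → evenWeight v * g v))

  evenSum-* : ∀ c f → evenSum (λ v → c * f v) ≡ c * evenSum f
  evenSum-* c f = trans (sumᵛ-cong {n} (λ v → x*[y*z]≡y*[x*z] (evenWeight v) c (f v))) (sym (*-distribˡ-sumᵛ c (λ v → evenWeight v * f v)))
    where
    x*[y*z]≡y*[x*z] : ∀ x y z → x * (y * z) ≡ y * (x * z)
    x*[y*z]≡y*[x*z] = solve-∀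

  evenSum-1 : evenSum (λ _ → 1) ≡ H
  evenSum-1 = trans (sumᵛ-cong {n} (λ v → *-identityʳ (evenWeight v))) (sumᵛ-evenWeight n′)

  evenSum-sum : ∀ {k} (f : Fin k → V n → ℕ) → evenSum (λ v → ∑[ i < k ] f i v) ≡ ∑[ i < k ] evenSum (f i)
  evenSum-sum f = trans (sumᵛ-cong {n} (λ v → *-distribˡ-sum (evenWeight v) (λ i → f i v))) (sumᵛ-comm (λ v i → evenWeight v * f i v))

  evenSum-mono-≤ : ∀ {f g} → (∀ v → f v ≤ g v) → evenSum f ≤ evenSum g
  evenSum-mono-≤ f≤g = sumᵛ-mono-≤ {n} (λ v → *-monoʳ-≤ (evenWeight v) (f≤g v))

  total slack : V n → ℕ
  total v = ∑[ i < m ] degree i v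
  slack v = n ∸ total v

  total+slack : ∀ v → total v + slack v ≡ m + m
  total+slack v = trans (m+[n∸m]≡n (sum-degree≤ v)) n≡m+m

  inner : Fin m → V n → ℕ
  inner i v = indicator (does (2 ≤? degree i v))

  inner-yes : ∀ {i v} → 2 ≤ degree i v → inner i v ≡ 1
  inner-yes {i} {v} deg≥2 = cong indicator (dec-true (2 ≤? degree i v) deg≥2)

  inner-no : ∀ {i v} → ¬ 2 ≤ degree i v → inner i v ≡ 0
  inner-no {i} {v} deg≱2 = cong indicator (dec-false (2 ≤? degree i v) deg≱2)

  leaf : ∀ i v → ¬ 2 ≤ degree i v → degree i v ≡ 1
  leaf i v deg≱2 = ≤-antisym (≤-pred (≰⇒> deg≱2)) (degree-positive i v)

  -- At an inner vertex of tree i all other trees have degree 1, so degree i v = m + 1 − slack v.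
  degree+slack : ∀ i v → degree i v + inner i v * slack v ≡ 1 + inner i v * m
  degree+slack i v with 2 ≤? degree i v
  ... | no  deg≱2 = begin
    degree i v + inner i v * slack v  ≡⟨ cong (λ c → degree i v + c * slack v) (inner-no deg≱2) ⟩
    degree i v + 0                    ≡⟨ trans (+-identityʳ _) (leaf i v deg≱2) ⟩
    1                                 ≡⟨ cong (λ c → 1 + c * m) (sym (inner-no deg≱2)) ⟩
    1 + inner i v * m                 ∎
    where open ≡-Reasoning
  ... | yes deg≥2 = begin
    degree i v + inner i v * slack v  ≡⟨ cong (λ c → degree i v + c * slack v) (inner-yes deg≥2) ⟩
    degree i v + 1 * slack v          ≡⟨ +-cancelʳ-≡ m _ _ (begin
      degree i v + 1 * slack v + m      ≡⟨ rearrange (degree i v) (slack v) m ⟩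
      (degree i v + m * 1) + slack v    ≡⟨ cong (_+ slack v) (sym (sum-single (λ k → degree k v) i others)) ⟩
      (total v + 1) + slack v           ≡⟨ rearrange′ (total v) (slack v) ⟩
      (total v + slack v) + 1           ≡⟨ cong (_+ 1) (total+slack v) ⟩
      m + m + 1                         ≡⟨ rearrange″ m ⟩
      1 + 1 * m + m                     ∎) ⟩
    1 + 1 * m                         ≡⟨ cong (λ c → 1 + c * m) (sym (inner-yes deg≥2)) ⟩
    1 + inner i v * m                 ∎
    where
    open ≡-Reasoning
    others : ∀ k → k ≢ i → degree k v ≡ 1
    others k k≢i = leaf k v (λ degₖ≥2 → inner-in-one-tree v k≢i degₖ≥2 deg≥2)
    rearrange : ∀ d s m → d + 1 * s + m ≡ (d + m * 1) + s
    rearrange = solve-∀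
    rearrange′ : ∀ t s → (t + 1) + s ≡ (t + s) + 1
    rearrange′ = solve-∀
    rearrange″ : ∀ m → m + m + 1 ≡ 1 + 1 * m + m
    rearrange″ = solve-∀

  inner≤1 : ∀ i v → inner i v ≤ 1
  inner≤1 i v = indicator≤1 _

  inner⇒degree≥2 : ∀ {i v} → 1 ≤ inner i v → 2 ≤ degree i v
  inner⇒degree≥2 {i} {v} 1≤inner with 2 ≤? degree i v
  ... | yes deg≥2 = deg≥2
  ... | no  deg≱2 = ⊥-elim (1+n≰n (≤-trans 1≤inner (≤-reflexive (inner-no deg≱2))))

  sum-inner≤1 : ∀ v → ∑[ i < m ] inner i v ≤ 1
  sum-inner≤1 v with 2 ≤? ∑[ i < m ] inner i v
  ... | no  sum≱2 = ≤-pred (≰⇒> sum≱2)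
  ... | yes sum≥2 with sum≥2⇒two-terms≥1 (λ i → inner i v) (λ i → inner≤1 i v) sum≥2
  ...   | i , k , i≢k , innerᵢ , innerₖ = ⊥-elim (inner-in-one-tree v i≢k (inner⇒degree≥2 innerᵢ) (inner⇒degree≥2 innerₖ))

  innerSlack innerCount : Fin m → ℕ
  innerSlack i = evenSum (λ v → inner i v * slack v)
  innerCount i = evenSum (inner i)

  H+innerSlack : ∀ i → H + innerSlack i ≡ innerCount i * m + 1
  H+innerSlack i = +-cancelˡ-≡ H _ _ (begin
    H + (H + innerSlack i)
      ≡⟨ rearrange H (innerSlack i) ⟩
    (H + (H + 0)) + innerSlack i
      ≡⟨ cong (_+ innerSlack i) (sym (sum-evenWeight-degree i)) ⟩
    (evenSum (degree i) + 1) + innerSlack i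
      ≡⟨ rearrange′ (evenSum (degree i)) (innerSlack i) ⟩
    (evenSum (degree i) + innerSlack i) + 1
      ≡⟨ cong (_+ 1) (sym (evenSum-+ (degree i) (λ v → inner i v * slack v))) ⟩
    evenSum (λ v → degree i v + inner i v * slack v) + 1
      ≡⟨ cong (_+ 1) (evenSum-cong (degree+slack i)) ⟩
    evenSum (λ v → 1 + inner i v * m) + 1
      ≡⟨ cong (_+ 1) (evenSum-+ (λ _ → 1) (λ v → inner i v * m)) ⟩
    (evenSum (λ _ → 1) + evenSum (λ v → inner i v * m)) + 1
      ≡⟨ cong₂ (λ x y → (x + y) + 1) evenSum-1 (trans (evenSum-cong (λ v → *-comm (inner i v) m)) (evenSum-* m (inner i))) ⟩
    (H + m * innerCount i) + 1
      ≡⟨ rearrange″ H m (innerCount i) ⟩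
    H + (innerCount i * m + 1) ∎)
    where
    open ≡-Reasoning
    rearrange : ∀ h s → h + (h + s) ≡ (h + (h + 0)) + s
    rearrange = solve-∀
    rearrange′ : ∀ d s → (d + 1) + s ≡ (d + s) + 1
    rearrange′ = solve-∀
    rearrange″ : ∀ h m c → (h + m * c) + 1 ≡ h + (c * m + 1)
    rearrange″ = solve-∀

  evenSum-slack : evenSum slack ≡ m
  evenSum-slack = +-cancelˡ-≡ (evenSum total) _ _ (begin
    evenSum total + evenSum slack
      ≡⟨ sym (evenSum-+ total slack) ⟩
    evenSum (λ v → total v + slack v)
      ≡⟨ evenSum-cong (λ v → trans (total+slack v) (sym (*-identityʳ (m + m)))) ⟩
    evenSum (λ _ → (m + m) * 1)
      ≡⟨ trans (evenSum-* (m + m) (λ _ → 1)) (cong ((m + m) *_) evenSum-1) ⟩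
    (m + m) * H
      ≡⟨ rearrange m H ⟩
    m * (H + (H + 0))
      ≡⟨ sym (sum-const m _) ⟩
    ∑[ i < m ] (H + (H + 0))
      ≡⟨ sym (sum-cong-≗ sum-evenWeight-degree) ⟩
    ∑[ i < m ] (evenSum (degree i) + 1)
      ≡⟨ ∑-distrib-+ (λ i → evenSum (degree i)) (λ _ → 1) ⟩
    ∑[ i < m ] evenSum (degree i) + ∑[ i < m ] 1
      ≡⟨ cong₂ _+_ (sym (evenSum-sum degree)) (trans (sum-const m 1) (*-identityʳ m)) ⟩
    evenSum total + m ∎)
    where
    open ≡-Reasoning
    rearrange : ∀ m h → (m + m) * h ≡ m * (h + (h + 0))
    rearrange = solve-∀

  sum-innerSlack≤m : ∑[ i < m ] innerSlack i ≤ m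
  sum-innerSlack≤m = begin
    ∑[ i < m ] innerSlack i
      ≡⟨ sym (evenSum-sum (λ i v → inner i v * slack v)) ⟩
    evenSum (λ v → ∑[ i < m ] (inner i v * slack v))
      ≤⟨ evenSum-mono-≤ at-most-slack ⟩
    evenSum slack
      ≡⟨ evenSum-slack ⟩
    m ∎
    where
    open ≤-Reasoning
    at-most-slack : ∀ v → ∑[ i < m ] (inner i v * slack v) ≤ slack v
    at-most-slack v = begin
      ∑[ i < m ] (inner i v * slack v)  ≡⟨ sym (*-distribʳ-sum (slack v) (λ i → inner i v)) ⟩
      (∑[ i < m ] inner i v) * slack v  ≤⟨ *-monoˡ-≤ (slack v) (sum-inner≤1 v) ⟩
      1 * slack v                       ≡⟨ *-identityˡ (slack v) ⟩
      slack v                           ∎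

  residue : H % m ≡ 0 ⊎ H % m ≡ 1 % m
  residue with sum<⇒term< innerSlack (≤-<-trans sum-innerSlack≤m (m<m*n m 2 (s≤s (s≤s z≤n))))
  ... | i , innerSlack<2 with innerSlack i | H+innerSlack i
  ...   | zero     | eq = inj₂ (trans (cong (_% m) (trans (sym (+-identityʳ H)) (trans eq (+-comm _ 1)))) ([m+kn]%n≡m%n 1 (innerCount i) m))
  ...   | suc zero | eq = inj₁ (trans (cong (_% m) (+-cancelʳ-≡ 1 _ _ eq)) (m*n%n≡0 (innerCount i) m))
  ...   | suc (suc _) | _ = ⊥-elim (<⇒≱ innerSlack<2 (s≤s (s≤s z≤n)))


cists⇒residue : ∀ {n′ m} .{{_ : NonZero m}} → suc n′ ≡ m + m → HasCISTs (suc n′) m →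
                2 ^ n′ % m ≡ 0 ⊎ 2 ^ n′ % m ≡ 1 % m
cists⇒residue n≡m+m (T , cists) =
  DegreeCounting.residue n≡m+m degree (λ i → Treeᵢ.sum-evenWeight-degree i) sum-degree≤
    (λ i v → Treeᵢ.degree-positive i (flip-≢ v zero)) inner-in-one-tree
  where open CISTDegrees T cists


-- Powers of two modulo m

odd⇒coprime-2 : ∀ {m} → ¬ 2 ∣ m → Coprime m 2
odd⇒coprime-2 2∤m (d∣m , d∣2) with prime⇒irreducible prime[2] d∣2
... | inj₁ d≡1    = d≡1
... | inj₂ refl   = ⊥-elim (2∤m d∣m)

∣2^⇒IsPowerOf2 : ∀ e {m} → m ∣ 2 ^ e → IsPowerOf2 m
∣2^⇒IsPowerOf2 zero    m∣1 = 0 , ∣1⇒≡1 m∣1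
∣2^⇒IsPowerOf2 (suc e) {m} m∣2^1+e with 2 ∣? m
... | no  2∤m = ∣2^⇒IsPowerOf2 e (coprime-divisor (odd⇒coprime-2 2∤m) m∣2^1+e)
... | yes (divides q refl) with ∣2^⇒IsPowerOf2 e {q} (*-cancelʳ-∣ 2 (subst (q * 2 ∣_) (*-comm 2 (2 ^ e)) m∣2^1+e))
...   | j , refl = suc j , *-comm (2 ^ j) 2

%-divisor : ∀ {d m} x y .{{_ : NonZero d}} .{{_ : NonZero m}} → d ∣ m → x % m ≡ y % m → x % d ≡ y % d
%-divisor {d} {m} x y d∣m eq = trans (sym (m∣n⇒o%n%m≡o%m d m x d∣m)) (trans (cong (_% d) eq) (m∣n⇒o%n%m≡o%m d m y d∣m))

2^[2*e] : ∀ e → 2 ^ (2 * e) ≡ 2 ^ e * 2 ^ e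
2^[2*e] e = trans (cong (2 ^_) (cong (e +_) (+-identityʳ e))) (^-distribˡ-+-* 2 e e)

module _ {m : ℕ} .{{_ : NonZero m}} where

  %-*ˡ : ∀ a b → (a * (b % m)) % m ≡ (a * b) % m
  %-*ˡ a b = trans (%-distribˡ-* a (b % m) m) (trans (cong (λ x → ((a % m) * x) % m) (m%n%n≡m%n b m)) (sym (%-distribˡ-* a b m)))

  %-scaledSquare : ∀ c y → (c * ((y % m) * (y % m))) % m ≡ (c * (y * y)) % m
  %-scaledSquare c y = begin
    (c * ((y % m) * (y % m))) % m        ≡⟨ sym (%-*ˡ c _) ⟩
    (c * (((y % m) * (y % m)) % m)) % m  ≡⟨ cong (λ x → (c * x) % m) (sym (%-distribˡ-* y y m)) ⟩
    (c * ((y * y) % m)) % m              ≡⟨ %-*ˡ c (y * y) ⟩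
    (c * (y * y)) % m                    ∎
    where open ≡-Reasoning

2^[1+e]%2≢1 : ∀ e → 2 ^ suc e % 2 ≢ 1
2^[1+e]%2≢1 e ≡1 = 0≢1+n (trans (sym (m*n%n≡0 (2 ^ e) 2)) (trans (cong (_% 2) (*-comm (2 ^ e) 2)) ≡1))

2^odd-step : ∀ k {m} .{{_ : NonZero m}} → 2 ^ suc (suc k * 2) % m ≡ (4 * (2 ^ suc (k * 2) % m)) % m
2^odd-step k {m} = trans (cong (_% m) (2*[2*x]≡4*x (2 ^ suc (k * 2)))) (sym (%-*ˡ 4 _))
  where
  2*[2*x]≡4*x : ∀ x → 2 * (2 * x) ≡ 4 * x
  2*[2*x]≡4*x = solve-∀

2^odd%3≡2 : ∀ k → 2 ^ suc (k * 2) % 3 ≡ 2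
2^odd%3≡2 zero    = refl
2^odd%3≡2 (suc k) = trans (2^odd-step k) (cong (λ r → (4 * r) % 3) (2^odd%3≡2 k))

2^odd%5∈2,3 : ∀ k → 2 ^ suc (k * 2) % 5 ≡ 2 ⊎ 2 ^ suc (k * 2) % 5 ≡ 3
2^odd%5∈2,3 zero    = inj₁ refl
2^odd%5∈2,3 (suc k) with 2^odd%5∈2,3 k
... | inj₁ ≡2 = inj₂ (trans (2^odd-step k) (cong (λ r → (4 * r) % 5) ≡2))
... | inj₂ ≡3 = inj₁ (trans (2^odd-step k) (cong (λ r → (4 * r) % 5) ≡3))

2^odd%3≢1 : ∀ k → 2 ^ suc (k * 2) % 3 ≢ 1
2^odd%3≢1 k ≡1 with trans (sym (2^odd%3≡2 k)) ≡1
... | ()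

2^odd%5≢1 : ∀ k → 2 ^ suc (k * 2) % 5 ≢ 1
2^odd%5≢1 k ≡1 with 2^odd%5∈2,3 k
... | inj₁ ≡2 with trans (sym ≡2) ≡1
...   | ()
2^odd%5≢1 k ≡1 | inj₂ ≡3 with trans (sym ≡3) ≡1
...   | ()

module _ (m : ℕ) .{{_ : NonZero m}} where

  -- The recursive result enters as an argument, so it is computed once and then squared.
  scaledSquareMod : ℕ → ℕ → ℕ
  scaledSquareMod c y = (c * (y * y)) % m

  pow2Mod : ℕᵇ → ℕ
  pow2Mod 0ᵇ       = 1 % m
  pow2Mod 2[1+ x ] = scaledSquareMod 4 (pow2Mod x)
  pow2Mod 1+[2 x ] = scaledSquareMod 2 (pow2Mod x)

  pow2Mod-correct : ∀ x → pow2Mod x ≡ 2 ^ toℕ x % m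
  pow2Mod-correct 0ᵇ       = refl
  pow2Mod-correct 2[1+ x ] = begin
    scaledSquareMod 4 (pow2Mod x)                ≡⟨ cong (scaledSquareMod 4) (pow2Mod-correct x) ⟩
    (4 * ((2 ^ t % m) * (2 ^ t % m))) % m        ≡⟨ %-scaledSquare 4 (2 ^ t) ⟩
    (4 * (2 ^ t * 2 ^ t)) % m                    ≡⟨ cong (_% m) (trans (4*[x*x]≡[2*x]*[2*x] (2 ^ t)) (sym (2^[2*e] (suc t)))) ⟩
    2 ^ (2 * suc t) % m                          ∎
    where
    open ≡-Reasoning
    t = toℕ x
    4*[x*x]≡[2*x]*[2*x] : ∀ x → 4 * (x * x) ≡ (2 * x) * (2 * x)
    4*[x*x]≡[2*x]*[2*x] = solve-∀
  pow2Mod-correct 1+[2 x ] = begin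
    scaledSquareMod 2 (pow2Mod x)                ≡⟨ cong (scaledSquareMod 2) (pow2Mod-correct x) ⟩
    (2 * ((2 ^ t % m) * (2 ^ t % m))) % m        ≡⟨ %-scaledSquare 2 (2 ^ t) ⟩
    (2 * (2 ^ t * 2 ^ t)) % m                    ≡⟨ cong (λ y → (2 * y) % m) (sym (2^[2*e] t)) ⟩
    2 ^ suc (2 * t) % m                          ∎
    where
    open ≡-Reasoning
    t = toℕ x

exceptionalDimensions : List ℕ
exceptionalDimensions = 161038 ∷ 215326 ∷ 2568226 ∷ 3020626 ∷ 7866046 ∷ 9115426 ∷ []

-- A test that 2 ^ (2m − 1) ≢ 1 (mod m). The last disjunct alone would do; the divisibility tests
-- by 2, 3 and 5, each of which settles the question, merely spare most moduli the exponentiation.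
refutes : ℕ → Bool
refutes zero        = false
refutes m@(suc k) = (m % 2 ≡ᵇ 0) ∨ (m % 3 ≡ᵇ 0) ∨ (m % 5 ≡ᵇ 0) ∨ not (pow2Mod m (1+[2 fromℕ k ]) ≡ᵇ 1 % m)

T-not-≡ᵇ : ∀ a b → T (not (a ≡ᵇ b)) → a ≢ b
T-not-≡ᵇ a b t a≡b = subst T (Equivalence.to T-not-≡ t) (≡⇒≡ᵇ a b a≡b)

T-%≡ᵇ0⇒∣ : ∀ m d .{{_ : NonZero d}} → T (m % d ≡ᵇ 0) → d ∣ m
T-%≡ᵇ0⇒∣ m d t = m%n≡0⇒n∣m m d (≡ᵇ⇒≡ (m % d) 0 t)

refutes-sound : ∀ k → T (refutes (suc k)) → 2 ^ suc (k * 2) % suc k ≢ 1 % suc k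
refutes-sound k t with Equivalence.to T-∨ t
... | inj₁ 2∣m = 2^[1+e]%2≢1 (k * 2) ∘ %-divisor (2 ^ suc (k * 2)) 1 (T-%≡ᵇ0⇒∣ (suc k) 2 2∣m)
... | inj₂ t′ with Equivalence.to T-∨ t′
...   | inj₁ 3∣m = 2^odd%3≢1 k ∘ %-divisor (2 ^ suc (k * 2)) 1 (T-%≡ᵇ0⇒∣ (suc k) 3 3∣m)
...   | inj₂ t″ with Equivalence.to T-∨ t″
...     | inj₁ 5∣m = 2^odd%5≢1 k ∘ %-divisor (2 ^ suc (k * 2)) 1 (T-%≡ᵇ0⇒∣ (suc k) 5 5∣m)
...     | inj₂ t‴ = T-not-≡ᵇ _ _ t‴ ∘ trans (pow2Mod-correct (suc k) (1+[2 fromℕ k ]))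
                      ∘ trans (cong (λ e → 2 ^ suc e % suc k) (trans (cong (2 *_) (toℕ-fromℕ k)) (*-comm 2 k)))

passes : ℕ → Bool
passes m = refutes m ∨ isYes (m * 2 ∈? exceptionalDimensions)

passesUpTo : ℕ → Bool
passesUpTo (suc (suc m)) = passes (suc (suc m)) ∧ passesUpTo (suc m)
passesUpTo _             = true

passesUpTo-sound : ∀ M → passesUpTo M ≡ true → ∀ {m} → 2 ≤ m → m ≤ M → T (passes m)
passesUpTo-sound zero          _ (s≤s _)  ()
passesUpTo-sound (suc zero)    _ (s≤s ()) (s≤s z≤n)
passesUpTo-sound (suc (suc M)) checked 2≤m m≤M =
  [ (λ m<M → passesUpTo-sound (suc M) (Equivalence.to T-≡ (proj₂ passes∧rest)) 2≤m (≤-pred m<M))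
  , (λ { refl → proj₁ passes∧rest }) ]′ (m≤n⇒m<n∨m≡n m≤M)
  where
  passes∧rest : T (passes (suc (suc M))) × T (passesUpTo (suc M))
  passes∧rest = Equivalence.to T-∧ (Equivalence.from T-≡ checked)

passes-sound : ∀ k → T (passes (suc k)) → 2 ^ suc (k * 2) % suc k ≡ 1 % suc k → suc k * 2 ∈ exceptionalDimensions
passes-sound k t unit with Equivalence.to T-∨ t
... | inj₁ refuted     = ⊥-elim (refutes-sound k refuted unit)
... | inj₂ exceptional = toWitness exceptional

passesUpTo-5000000 : passesUpTo 5000000 ≡ true
passesUpTo-5000000 = refl

unit-residue⇒exceptional : ∀ {m} .{{_ : NonZero m}} → 2 ≤ m → m ≤ 5000000 → 2 ^ pred (m * 2) % m ≡ 1 % m →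
                           m * 2 ∈ exceptionalDimensions
unit-residue⇒exceptional {suc k} 2≤m m≤ unit =
  passes-sound k (passesUpTo-sound 5000000 passesUpTo-5000000 2≤m m≤) unit


∉-exceptionalDimensions : ∀ {n} → n ≢ 161038 → n ≢ 215326 → n ≢ 2568226 → n ≢ 3020626 → n ≢ 7866046 → n ≢ 9115426 →
                          n ∉ exceptionalDimensions
∉-exceptionalDimensions n≢₁ _ _ _ _ _ (here n≡₁)                                         = n≢₁ n≡₁
∉-exceptionalDimensions _ n≢₂ _ _ _ _ (there (here n≡₂))                                 = n≢₂ n≡₂
∉-exceptionalDimensions _ _ n≢₃ _ _ _ (there (there (here n≡₃)))                         = n≢₃ n≡₃
∉-exceptionalDimensions _ _ _ n≢₄ _ _ (there (there (there (here n≡₄))))                 = n≢₄ n≡₄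
∉-exceptionalDimensions _ _ _ _ n≢₅ _ (there (there (there (there (here n≡₅)))))         = n≢₅ n≡₅
∉-exceptionalDimensions _ _ _ _ _ n≢₆ (there (there (there (there (there (here n≡₆)))))) = n≢₆ n≡₆

IsPowerOf2-*2 : ∀ {m} → IsPowerOf2 m → IsPowerOf2 (m * 2)
IsPowerOf2-*2 (j , refl) = suc j , *-comm (2 ^ j) 2

proposition4p2 : (n : ℕ) → 2 ∣ n → 2 < n → n ≤ 10 ^ 7 → ¬ IsPowerOf2 n →
    n ≢ 161038 → n ≢ 215326 → n ≢ 2568226 → n ≢ 3020626 → n ≢ 7866046 → n ≢ 9115426 →
    ¬ HasCISTs n (n / 2)
proposition4p2 .(0 * 2) (divides 0 refl) ()
proposition4p2 .(1 * 2) (divides 1 refl) (s≤s (s≤s ()))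
-- Case analysis by [_,_]′ rather than `with`: abstracting over the residue makes Agda normalise
-- the proof term, which exhausts memory.
proposition4p2 .(m * 2) (divides m@(suc (suc _)) refl) _ n≤10⁷ n≠2^ n≢₁ n≢₂ n≢₃ n≢₄ n≢₅ n≢₆ cists
  = [ n≠2^ ∘ IsPowerOf2-*2 ∘ ∣2^⇒IsPowerOf2 (pred (m * 2)) ∘ m%n≡0⇒n∣m (2 ^ pred (m * 2)) m
    , ∉-exceptionalDimensions n≢₁ n≢₂ n≢₃ n≢₄ n≢₅ n≢₆ ∘ unit-residue⇒exceptional (s≤s (s≤s z≤n)) (*-cancelʳ-≤ m 5000000 2 n≤10⁷)
    ]′ (cists⇒residue (trans (*-comm m 2) (cong (m +_) (+-identityʳ m))) (subst (HasCISTs (m * 2)) (m*n/n≡m m 2) cists))
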